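{- Let $G=(V_G,E_G)$ be a finite simple undirected graph and let $\delta\colon E_G\to\{\text{blue},\text{red}\}$ be a coloring of its edges. Let $G^\delta_{\text{red}}=(V_G,\{e\in E_G:\delta(e)=\text{red}\})$ and $G^\delta_{\text{blue}}=(V_G,\{e\in E_G:\delta(e)=\text{blue}\})$. Then there are no almost blue cycles and no almost red cycles in $G$ if and only if every connected component of $G^\delta_{\text{red}}$ and every connected component of $G^\delta_{\text{blue}}$ is an induced subgraph of $G$.
   Context: A cycle in $G$ is an almost red cycle if exactly one of its edges is blue (all others red); an almost blue cycle is defined analogously (exactly one edge red, all others blue). -}

module Defs where

open import Data.Nat using (ℕ; zero; suc; _≤_)
open import Data.Fin using (Fin; zero; suc; inject₁; fromℕ)
open import Data.Bool using (Bool; true; false)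
open import Data.List using (List; []; _∷_; _++_; map; length; filter)
open import Data.List.Base using (allFin)
open import Data.Product using (Σ; _×_; _,_)
open import Relation.Binary.PropositionalEquality using (_≡_; _≢_)
open import Relation.Nullary using (¬_; Dec; yes; no)
open import Function.Definitions using (Injective)

record Graph (n : ℕ) : Set where
  field
    E     : Fin n → Fin n → Bool
    sym   : ∀ u v → E u v ≡ E v u
    irrefl : ∀ v → E v v ≡ false
open Graph public

data Colour : Set where
  blue red : Colour

_≟ᶜ_ : (a b : Colour) → Dec (a ≡ b)
blue ≟ᶜ blue = yes _≡_.refl
blue ≟ᶜ red  = no λ ()
red  ≟ᶜ blue = no λ ()
red  ≟ᶜ red  = yes _≡_.refl

-- An edge colouring δ : E_G → {blue, red}, given as a function on vertex
-- pairs which is symmetric on edges (its values on non-edges are irrelevant).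
record Colouring {n : ℕ} (G : Graph n) : Set where
  field
    δ     : Fin n → Fin n → Colour
    δ-sym : ∀ u v → E G u v ≡ true → δ u v ≡ δ v u
open Colouring public

-- A cycle of length suc m (m ≥ 2, so length ≥ 3): pairwise distinct vertices
-- v 0, …, v m with v i ~ v (i+1) for i < m and v m ~ v 0.
record Cycle {n : ℕ} (G : Graph n) : Set where
  field
    m      : ℕ
    len≥3  : 2 ≤ m
    vtx    : Fin (suc m) → Fin n
    inj    : Injective _≡_ _≡_ vtx
    step   : ∀ (i : Fin m) → E G (vtx (inject₁ i)) (vtx (suc i)) ≡ true
    close  : E G (vtx (fromℕ m)) (vtx zero) ≡ true
open Cycle public

cycleEdges : ∀ {n} {G : Graph n} → Cycle G → List (Fin n × Fin n)
cycleEdges C =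
  map (λ i → vtx C (inject₁ i) , vtx C (suc i)) (allFin (m C))
  ++ ((vtx C (fromℕ (m C)) , vtx C zero) ∷ [])

numColoured : ∀ {n} {G : Graph n} → Colouring G → Colour → Cycle G → ℕ
numColoured κ c C =
  length (filter (λ { (u , v) → δ κ u v ≟ᶜ c }) (cycleEdges C))

AlmostRed : ∀ {n} {G : Graph n} → Colouring G → Cycle G → Set
AlmostRed κ C = numColoured κ blue C ≡ 1

AlmostBlue : ∀ {n} {G : Graph n} → Colouring G → Cycle G → Set
AlmostBlue κ C = numColoured κ red C ≡ 1

data Reach {n} {G : Graph n} (κ : Colouring G) (c : Colour) :
           Fin n → Fin n → Set where
  here  : ∀ {u} → Reach κ c u u
  there : ∀ {u w v} → E G u w ≡ true → δ κ u w ≡ c →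
          Reach κ c w v → Reach κ c u v

-- The connected component of G^δ_c containing x:
-- vertices reachable from x, and edges of colour c between them.
CompVertex : ∀ {n} {G : Graph n} → Colouring G → Colour → Fin n → Fin n → Set
CompVertex κ c x v = Reach κ c x v

CompEdge : ∀ {n} {G : Graph n} → Colouring G → Colour → Fin n →
           Fin n → Fin n → Set
CompEdge {G = G} κ c x u v =
  CompVertex κ c x u × CompVertex κ c x v × E G u v ≡ true × δ κ u v ≡ c

ComponentInduced : ∀ {n} {G : Graph n} → Colouring G → Colour → Fin n → Set
ComponentInduced {G = G} κ c x =
  ∀ u v → CompVertex κ c x u → CompVertex κ c x v →
  E G u v ≡ true → CompEdge κ c x u v

module Submission where

-- Fix a colour c and write c̄ for the other colour.  Call the
-- colouring c-closed if every edge of G joining two vertices that are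
-- connected in the monochromatic graph G_c has colour c.  For each c we show
--
--   (1) every component of G_c is an induced subgraph of G  ⇔  κ is c-closed;
--   (2) κ is c-closed  ⇔  G has no cycle with exactly one edge of colour c̄.
--
-- (1) is bookkeeping with reachability.  For (2, ⇐) take an edge uv of colour
-- c̄ whose endpoints are joined by a c-walk; shortcutting the walk gives a
-- simple c-path from u to v of length ≥ 2, which closes up with uv to a cycle
-- having exactly one c̄-edge.  For (2, ⇒) cut a cycle with exactly one c̄-edge
-- into its path part and its closing edge: whichever of the two carries the
-- c̄-edge, its endpoints are c-connected through the rest of the cycle, so
-- closedness forces that edge to have colour c, a contradiction.  The theorem
-- is (1) and (2) for c = red (c̄ = blue) and for c = blue (c̄ = red).

open import Defs hiding (sym)
open import Data.Nat using (ℕ; zero; suc; _+_; _≤_; z≤n; s≤s)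
open import Data.Nat.Properties using (+-identityʳ; +-cancelʳ-≡) renaming (suc-injective to ℕ-suc-injective)
open import Data.Fin using (Fin; zero; suc; inject₁; fromℕ)
open import Data.Fin.Properties using (any?; suc-injective) renaming (_≟_ to _≟ᶠ_)
open import Data.Product using (Σ; _×_; _,_; proj₁; proj₂; uncurry)
open import Data.List using (List; []; _∷_; _++_; length; filter; tabulate)
open import Data.List.Properties using (map-tabulate)
open import Data.Empty using (⊥-elim)
open import Data.Bool using (true)
open import Relation.Nullary using (¬_; yes; no)
open import Relation.Binary.PropositionalEquality
  using (_≡_; _≢_; refl; sym; trans; cong; cong₂; subst; subst₂; module ≡-Reasoning)
open import Function.Base using (id)
open import Function.Bundles using (_⇔_; mk⇔; Equivalence)
open import Function.Properties.Equivalence using () renaming (trans to ⇔-trans)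
open import Function.Definitions using (Injective)

opposite : Colour → Colour
opposite blue = red
opposite red  = blue

opposite-≢ : ∀ c → opposite c ≢ c
opposite-≢ blue ()
opposite-≢ red  ()

≢opposite⇒≡ : ∀ {a} c → a ≢ opposite c → a ≡ c
≢opposite⇒≡ {blue} blue _ = refl
≢opposite⇒≡ {red}  red  _ = refl
≢opposite⇒≡ {red}  blue h = ⊥-elim (h refl)
≢opposite⇒≡ {blue} red  h = ⊥-elim (h refl)

≢⇒≡opposite : ∀ {a} c → a ≢ c → a ≡ opposite c
≢⇒≡opposite {red}  blue _ = refl
≢⇒≡opposite {blue} red  _ = refl
≢⇒≡opposite {blue} blue h = ⊥-elim (h refl)
≢⇒≡opposite {red}  red  h = ⊥-elim (h refl)

module _ {n : ℕ} (G : Graph n) (κ : Colouring G) where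

  IsWalk : ∀ {k} → (Fin (suc k) → Fin n) → Set
  IsWalk f = ∀ i → E G (f (inject₁ i)) (f (suc i)) ≡ true

  Monochrome : Colour → ∀ {k} → (Fin (suc k) → Fin n) → Set
  Monochrome c f = ∀ i → δ κ (f (inject₁ i)) (f (suc i)) ≡ c

  walkEdges : ∀ {k} → (Fin (suc k) → Fin n) → List (Fin n × Fin n)
  walkEdges f = tabulate (λ i → f (inject₁ i) , f (suc i))

  count : Colour → List (Fin n × Fin n) → ℕ
  count c es = length (filter (λ e → δ κ (proj₁ e) (proj₂ e) ≟ᶜ c) es)

  count-++ : ∀ c xs ys → count c (xs ++ ys) ≡ count c xs + count c ys
  count-++ c [] ys = refl
  count-++ c ((a , b) ∷ xs) ys with δ κ a b ≟ᶜ c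
  ... | yes _ = cong suc (count-++ c xs ys)
  ... | no  _ = count-++ c xs ys

  count-edge-yes : ∀ {c a b} → δ κ a b ≡ c → count c ((a , b) ∷ []) ≡ 1
  count-edge-yes {c} {a} {b} p with δ κ a b ≟ᶜ c
  ... | yes _  = refl
  ... | no  np = ⊥-elim (np p)

  count-edge-no : ∀ {c a b} → δ κ a b ≢ c → count c ((a , b) ∷ []) ≡ 0
  count-edge-no {c} {a} {b} np with δ κ a b ≟ᶜ c
  ... | yes p = ⊥-elim (np p)
  ... | no  _ = refl

  closingEdge : Cycle G → Fin n × Fin n
  closingEdge C = vtx C (fromℕ (m C)) , vtx C zero

  count-cycle : ∀ c (C : Cycle G) →
    numColoured κ c C ≡ count c (walkEdges (vtx C)) + count c (closingEdge C ∷ [])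
  count-cycle c C =
    trans (cong (λ es → count c (es ++ closingEdge C ∷ []))
                (map-tabulate id (λ i → vtx C (inject₁ i) , vtx C (suc i))))
          (count-++ c (walkEdges (vtx C)) _)

  single-on-closing : ∀ {c} (C : Cycle G) → δ κ (vtx C (fromℕ (m C))) (vtx C zero) ≡ c →
                      numColoured κ c C ≡ 1 → count c (walkEdges (vtx C)) ≡ 0
  single-on-closing {c} C p one = +-cancelʳ-≡ 1 _ 0 (begin
    count c (walkEdges (vtx C)) + 1
      ≡⟨ cong (count c (walkEdges (vtx C)) +_) (count-edge-yes p) ⟨
    count c (walkEdges (vtx C)) + count c (closingEdge C ∷ [])
      ≡⟨ count-cycle c C ⟨
    numColoured κ c C
      ≡⟨ one ⟩
    1 ∎)
    where open ≡-Reasoning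

  single-on-path : ∀ {c} (C : Cycle G) → δ κ (vtx C (fromℕ (m C))) (vtx C zero) ≢ c →
                   numColoured κ c C ≡ 1 → count c (walkEdges (vtx C)) ≡ 1
  single-on-path {c} C np one = begin
    count c (walkEdges (vtx C))
      ≡⟨ +-identityʳ _ ⟨
    count c (walkEdges (vtx C)) + 0
      ≡⟨ cong (count c (walkEdges (vtx C)) +_) (count-edge-no np) ⟨
    count c (walkEdges (vtx C)) + count c (closingEdge C ∷ [])
      ≡⟨ count-cycle c C ⟨
    numColoured κ c C
      ≡⟨ one ⟩
    1 ∎
    where open ≡-Reasoning

  reach-trans : ∀ {c u w v} → Reach κ c u w → Reach κ c w v → Reach κ c u v
  reach-trans here          r' = r'
  reach-trans (there e d r) r' = there e d (reach-trans r r')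

  reach-snoc : ∀ {c u w v} → Reach κ c u w → E G w v ≡ true → δ κ w v ≡ c →
               Reach κ c u v
  reach-snoc r e d = reach-trans r (there e d here)

  reach-sym : ∀ {c u v} → Reach κ c u v → Reach κ c v u
  reach-sym here = here
  reach-sym (there {u} {w} e d r) =
    reach-snoc (reach-sym r) (trans (Graph.sym G w u) e) (trans (sym (δ-sym κ u w e)) d)

  monochrome-count : ∀ c {k} (f : Fin (suc k) → Fin n) → Monochrome c f →
                     count (opposite c) (walkEdges f) ≡ 0
  monochrome-count c {zero}  f mono = refl
  monochrome-count c {suc k} f mono with δ κ (f zero) (f (suc zero)) ≟ᶜ opposite c
  ... | yes p = ⊥-elim (opposite-≢ c (trans (sym p) (mono zero)))
  ... | no  _ = monochrome-count c (λ j → f (suc j)) (λ i → mono (suc i))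

  count0⇒reach : ∀ c {k} (f : Fin (suc k) → Fin n) → IsWalk f →
                 count (opposite c) (walkEdges f) ≡ 0 → Reach κ c (f zero) (f (fromℕ k))
  count0⇒reach c {zero}  f walk none = here
  count0⇒reach c {suc k} f walk none with δ κ (f zero) (f (suc zero)) ≟ᶜ opposite c
  count0⇒reach c {suc k} f walk () | yes _
  ... | no np = there (walk zero) (≢opposite⇒≡ c np)
                  (count0⇒reach c (λ j → f (suc j)) (λ i → walk (suc i)) none)

  record Crossing (c : Colour) (s t : Fin n) : Set where
    field
      a b    : Fin n
      edge   : E G a b ≡ true
      colour : δ κ a b ≡ opposite c
      before : Reach κ c s a
      after  : Reach κ c b t

  count1⇒crossing : ∀ c {k} (f : Fin (suc k) → Fin n) → IsWalk f →
                    count (opposite c) (walkEdges f) ≡ 1 → Crossing c (f zero) (f (fromℕ k))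
  count1⇒crossing c {zero}  f walk ()
  count1⇒crossing c {suc k} f walk one with δ κ (f zero) (f (suc zero)) ≟ᶜ opposite c
  ... | yes p = record
    { a = f zero ; b = f (suc zero) ; edge = walk zero ; colour = p ; before = here
    ; after = count0⇒reach c (λ j → f (suc j)) (λ i → walk (suc i)) (ℕ-suc-injective one) }
  ... | no np = record
    { a = a ; b = b ; edge = edge ; colour = colour ; after = after
    ; before = there (walk zero) (≢opposite⇒≡ c np) before }
    where open Crossing (count1⇒crossing c (λ j → f (suc j)) (λ i → walk (suc i)) one)

  Closed : Colour → Set
  Closed c = ∀ {u v} → Reach κ c u v → E G u v ≡ true → δ κ u v ≡ c

  induced⇔closed : ∀ c → (∀ x → ComponentInduced κ c x) ⇔ Closed c
  induced⇔closed c = mk⇔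
    (λ induced {u} {v} r e → proj₂ (proj₂ (proj₂ (induced u u v here r e))))
    (λ closed x u v ru rv e → ru , rv , e , closed (reach-trans (reach-sym ru) rv) e)

  closed⇒no-almost-cycle : ∀ c → Closed c → (C : Cycle G) → ¬ numColoured κ (opposite c) C ≡ 1
  closed⇒no-almost-cycle c closed C one
    with δ κ (vtx C (fromℕ (m C))) (vtx C zero) ≟ᶜ opposite c
  ... | yes p = opposite-≢ c (trans (sym p) (closed (reach-sym around) (close C)))
    where
      around : Reach κ c (vtx C zero) (vtx C (fromℕ (m C)))
      around = count0⇒reach c (vtx C) (step C) (single-on-closing C p one)
  ... | no np = opposite-≢ c (trans (sym colour) (closed (reach-sym b↝a) edge))
    where
      open Crossing (count1⇒crossing c (vtx C) (step C) (single-on-path C np one))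
      b↝a : Reach κ c b a
      b↝a = reach-trans after (there (close C) (≢opposite⇒≡ c np) before)

  record SimplePath (c : Colour) (u v : Fin n) : Set where
    constructor path
    field
      len        : ℕ
      vertex     : Fin (suc len) → Fin n
      starts     : vertex zero ≡ u
      ends       : vertex (fromℕ len) ≡ v
      injective  : Injective _≡_ _≡_ vertex
      walk       : IsWalk vertex
      monochrome : Monochrome c vertex
  open SimplePath

  suffix : ∀ {c u v} (P : SimplePath c u v) (j : Fin (suc (len P))) →
           SimplePath c (vertex P j) v
  suffix (path k f _ t inj w mono) zero = path k f refl t inj w mono
  suffix (path (suc k) f _ t inj w mono) (suc j) =
    suffix (path k (λ i → f (suc i)) refl t (λ eq → suc-injective (inj eq))
                 (λ i → w (suc i)) (λ i → mono (suc i))) j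

  prepend : ∀ {c u w v} → E G u w ≡ true → δ κ u w ≡ c → (P : SimplePath c w v) →
            (∀ j → u ≢ vertex P j) → SimplePath c u v
  prepend {c} {u} e d (path k f s t inj w mono) fresh = path (suc k) f′ refl t inj′ w′ mono′
    where
      f′ : Fin (suc (suc k)) → Fin n
      f′ zero    = u
      f′ (suc j) = f j
      inj′ : Injective _≡_ _≡_ f′
      inj′ {zero}  {zero}  _  = refl
      inj′ {zero}  {suc j} eq = ⊥-elim (fresh j eq)
      inj′ {suc i} {zero}  eq = ⊥-elim (fresh i (sym eq))
      inj′ {suc i} {suc j} eq = cong suc (inj eq)
      w′ : IsWalk f′
      w′ zero    = subst (λ x → E G u x ≡ true) (sym s) e
      w′ (suc i) = w i
      mono′ : Monochrome c f′
      mono′ zero    = subst (λ x → δ κ u x ≡ c) (sym s) d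
      mono′ (suc i) = mono i

  shortcut : ∀ {c u v} → Reach κ c u v → SimplePath c u v
  shortcut {u = u} here = path 0 (λ _ → u) refl refl (λ { {zero} {zero} _ → refl }) (λ ()) (λ ())
  shortcut {c} {u} {v} (there {w = w} e d r) = extend (shortcut r)
    where
      extend : SimplePath c w v → SimplePath c u v
      extend P with any? (λ j → u ≟ᶠ vertex P j)
      ... | yes (j , u≡) = subst (λ x → SimplePath c x v) (sym u≡) (suffix P j)
      ... | no  fresh    = prepend e d P (λ j eq → fresh (j , eq))

  -- A simple c-path between the ends of an edge not of colour c has length ≥ 2:
  -- length 0 would be a loop, length 1 would be that edge itself.
  path-length≥2 : ∀ {c u v} → E G u v ≡ true → δ κ u v ≢ c → (P : SimplePath c u v) → 2 ≤ len P
  path-length≥2 {u = u} e _ (path zero f s t _ _ _)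
    with trans (sym (subst (λ x → E G u x ≡ true) (trans (sym t) s) e)) (irrefl G u)
  ... | ()
  path-length≥2 {c} _ np (path (suc zero) f s t _ _ mono) =
    ⊥-elim (np (subst₂ (λ a b → δ κ a b ≡ c) s t (mono zero)))
  path-length≥2 _ _ (path (suc (suc k)) _ _ _ _ _ _) = s≤s (s≤s z≤n)

  almost-cycle : ∀ {c u v} → Reach κ c u v → E G u v ≡ true → δ κ u v ≢ c →
                 Σ (Cycle G) λ C → numColoured κ (opposite c) C ≡ 1
  almost-cycle {c} {u} {v} r e np = C , trans (count-cycle _ C)
    (cong₂ _+_ (monochrome-count c (vertex P) (monochrome P)) (count-edge-yes closing-colour))
    where
      P = shortcut r
      evu : E G v u ≡ true
      evu = trans (Graph.sym G v u) e
      C : Cycle G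
      C = record
        { m = len P ; len≥3 = path-length≥2 e np P ; vtx = vertex P ; inj = injective P ; step = walk P
        ; close = subst₂ (λ a b → E G a b ≡ true) (sym (ends P)) (sym (starts P)) evu }
      closing-colour : δ κ (vertex P (fromℕ (len P))) (vertex P zero) ≡ opposite c
      closing-colour = subst₂ (λ a b → δ κ a b ≡ opposite c) (sym (ends P)) (sym (starts P))
                         (trans (δ-sym κ v u evu) (≢⇒≡opposite c np))

  no-almost-cycle⇒closed : ∀ c → ((C : Cycle G) → ¬ numColoured κ (opposite c) C ≡ 1) → Closed c
  no-almost-cycle⇒closed c none {u} {v} r e with δ κ u v ≟ᶜ c
  ... | yes p  = p
  ... | no  np = ⊥-elim (uncurry none (almost-cycle r e np))

  induced⇔no-almost-cycle : ∀ c →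
    (∀ x → ComponentInduced κ c x) ⇔ ((C : Cycle G) → ¬ numColoured κ (opposite c) C ≡ 1)
  induced⇔no-almost-cycle c = ⇔-trans (induced⇔closed c)
    (mk⇔ (closed⇒no-almost-cycle c) (no-almost-cycle⇒closed c))

lemma1 : ∀ {n : ℕ} (G : Graph n) (κ : Colouring G) →
    (((C : Cycle G) → ¬ AlmostBlue κ C) × ((C : Cycle G) → ¬ AlmostRed κ C))
    ⇔ (((x : Fin n) → ComponentInduced κ red x) × ((x : Fin n) → ComponentInduced κ blue x))
lemma1 G κ = mk⇔
  (λ (noAlmostBlue , noAlmostRed) → from red noAlmostRed , from blue noAlmostBlue)
  (λ (redInduced , blueInduced) → to blue blueInduced , to red redInduced)
  where
    -- An almost blue cycle is one with exactly one red (= opposite blue) edge,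
    -- an almost red cycle one with exactly one blue (= opposite red) edge.
    to : ∀ c → (∀ x → ComponentInduced κ c x) →
         (C : Cycle G) → ¬ numColoured κ (opposite c) C ≡ 1
    to c = Equivalence.to (induced⇔no-almost-cycle G κ c)
    from : ∀ c → ((C : Cycle G) → ¬ numColoured κ (opposite c) C ≡ 1) →
           ∀ x → ComponentInduced κ c x
    from c = Equivalence.from (induced⇔no-almost-cycle G κ c)
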